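{- Consider the random walk on the positive integers defined as follows: from state $1$ it moves to state $2$ with probability $1$; from state $2$ it moves to state $1$ with probability $1/2$ and to state $3$ with probability $1/2$; from a state $k\ge 3$ it moves to $k-1$ with probability $3/4$ and to $k+1$ with probability $1/4$. Start the walk at state $1$ and let $N_{1,1}(t)$ be the number of times the walk returns to state $1$ during its first $t$ steps. Then with probability tending to $1$ as $t\to\infty$, $N_{1,1}(t)\ge t/19$. -}

module Defs where

open import Data.Nat using (ℕ; zero; suc; _≤ᵇ_)
open import Data.Nat as ℕ using ()
open import Data.Integer using (+_)
open import Data.Rational using (ℚ; 0ℚ; 1ℚ; ½; _/_; _+_; _*_)
open import Data.List using (List; []; _∷_)
open import Data.Product using (_×_; _,_)
open import Data.Bool using (Bool; true; false; if_then_else_)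

-- One-step transition law of the walk on the positive integers
-- (state 0 is unused; the walk started at 1 never reaches it).
-- step k = list of (probability, next state).
step : ℕ → List (ℚ × ℕ)
step zero = []
step (suc zero) = (1ℚ , 2) ∷ []
step (suc (suc zero)) = (½ , 1) ∷ (½ , 3) ∷ []
step (suc (suc (suc k))) =
  ((+ 3 / 4) , suc (suc k)) ∷ ((+ 1 / 4) , suc (suc (suc (suc k)))) ∷ []

isOne : ℕ → ℕ
isOne (suc zero) = 1
isOne _ = 0

-- probEvent t s c P : probability that, starting at state s with c returns
-- to state 1 already counted, after t further steps of the walk the total
-- number c' of visits to state 1 (counted at times 1..t) satisfies P c' ≡ true.
probEvent : ℕ → ℕ → ℕ → (ℕ → Bool) → ℚ
probEvent zero s c P = if P c then 1ℚ else 0ℚ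
probEvent (suc t) s c P = go (step s)
  where
  go : List (ℚ × ℕ) → ℚ
  go [] = 0ℚ
  go ((p , s') ∷ rest) = p * probEvent t s' (c ℕ.+ isOne s') P + go rest

-- P( N_{1,1}(t) ≥ t/19 ) for the walk started at state 1,
-- where N_{1,1}(t) = number of returns to 1 during the first t steps.
-- The event N ≥ t/19 is written as t ≤ 19 * N.
probManyReturns : ℕ → ℚ
probManyReturns t = probEvent t 1 0 (λ n → t ≤ᵇ 19 ℕ.* n)

-- Let N be the number of visits to 1. With γ = (10/11)^19 and a Lyapunov function V on the
-- states (V(k) = (3/2)^(k-2) for k ≥ 2), one step of the walk multiplies V(X)·γ^N by at most
-- ρ = 9/10 in expectation: away from 1 the drift towards 1 beats the growth of V, and the
-- excursion 2 → 1 is paid for by the factor γ. So E[V(X_t) γ^(N_t)] ≤ ρ^t V(1), and by Markov's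
-- inequality P(N_t < t/19) ≤ ρ^t V(1) γ^(-t/19) = V(1) (99/100)^t, since γ^(-1/19) = 11/10.
-- Bernoulli's inequality makes this eventually smaller than any ε > 0.

module Submission where

open import Defs
open import Data.Nat using (ℕ) renaming (_≤_ to _≤ℕ_)
open import Data.Rational using (ℚ; 0ℚ; 1ℚ; _-_; _≤_; _<_)
open import Data.Product using (Σ; _,_)

open import Algebra.Bundles using (CommutativeRing)
import Algebra.Properties.Semiring.Mult as SemiringMult
open import Data.Integer as ℤ using (+_; +[1+_]; -[1+_]; +<+)
import Data.Integer.Properties as ℤ
open import Data.Bool using (if_then_else_)
open import Data.List using (List; []; _∷_)
open import Data.Nat as ℕ using (zero; suc; _≤ᵇ_)
import Data.Nat.Properties as ℕ
open import Data.Product using (_×_)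
open import Data.Rational using (½; _/_; _+_; _*_; -_; mkℚ; ↧ₙ_; toℚᵘ; nonNegative; *<*)
open import Data.Rational.Properties
open import Data.Rational.Solver using (module +-*-Solver)
open import Data.Rational.Unnormalised as ℚᵘ using (mkℚᵘ; *≡*; *≤*)
  renaming (_≃_ to _≃ᵘ_)
import Data.Rational.Unnormalised.Properties as ℚᵘ
open import Relation.Binary.PropositionalEquality
open import Relation.Nullary.Reflects using (Reflects; ofʸ; ofⁿ)
open import Relation.Nullary.Negation using (¬_)

open +-*-Solver
open ≤-Reasoning

open import Algebra.Properties.CommutativeSemiring.Exp
  (CommutativeRing.commutativeSemiring +-*-commutativeRing) using (_^_; ^-homo-*; ^-assocʳ; ^-distrib-*)

private
  module ℚ-Mult = SemiringMult (CommutativeRing.semiring +-*-commutativeRing)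

expect : List (ℚ × ℕ) → (ℕ → ℚ) → ℚ
expect [] φ = 0ℚ
expect ((p , s) ∷ xs) φ = p * φ s + expect xs φ

expect-cong : ∀ xs {φ ψ} → (∀ s → φ s ≡ ψ s) → expect xs φ ≡ expect xs ψ
expect-cong [] φ≗ψ = refl
expect-cong ((p , s) ∷ xs) φ≗ψ = cong₂ (λ a b → p * a + b) (φ≗ψ s) (expect-cong xs φ≗ψ)

expect-*ʳ : ∀ xs φ w → expect xs (λ s → φ s * w) ≡ expect xs φ * w
expect-*ʳ [] φ w = sym (*-zeroˡ w)
expect-*ʳ ((p , s) ∷ xs) φ w = begin-equality
  p * (φ s * w) + expect xs (λ s → φ s * w)
    ≡⟨ cong₂ _+_ (sym (*-assoc p (φ s) w)) (expect-*ʳ xs φ w) ⟩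
  p * φ s * w + expect xs φ * w
    ≡⟨ *-distribʳ-+ w (p * φ s) (expect xs φ) ⟨
  (p * φ s + expect xs φ) * w
    ∎

expect-distrib-minus : ∀ xs φ ψ → expect xs (λ s → φ s - ψ s) ≡ expect xs φ - expect xs ψ
expect-distrib-minus [] φ ψ = refl
expect-distrib-minus ((p , s) ∷ xs) φ ψ = begin-equality
  p * (φ s - ψ s) + expect xs (λ s → φ s - ψ s)
    ≡⟨ cong (λ e → p * (φ s - ψ s) + e) (expect-distrib-minus xs φ ψ) ⟩
  p * (φ s - ψ s) + (expect xs φ - expect xs ψ)
    ≡⟨ solve 5 (λ p a b e f → p :* (a :- b) :+ (e :- f) := (p :* a :+ e) :- (p :* b :+ f))
         refl p (φ s) (ψ s) (expect xs φ) (expect xs ψ) ⟩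
  expect ((p , s) ∷ xs) φ - expect ((p , s) ∷ xs) ψ
    ∎

probEvent-suc : ∀ t s c P →
  probEvent (suc t) s c P ≡ expect (step s) (λ s′ → probEvent t s′ (c ℕ.+ isOne s′) P)
probEvent-suc t zero c P = refl
probEvent-suc t (suc zero) c P = refl
probEvent-suc t (suc (suc zero)) c P = refl
probEvent-suc t (suc (suc (suc s))) c P = refl

step-total : ∀ s → expect (step (suc s)) (λ _ → 1ℚ) ≡ 1ℚ
step-total zero = refl
step-total (suc zero) = refl
step-total (suc (suc s)) = refl

step-mono : ∀ s {φ ψ} → (∀ s′ → φ (suc s′) ≤ ψ (suc s′)) →
  expect (step (suc s)) φ ≤ expect (step (suc s)) ψ
step-mono zero φ≤ψ = +-monoˡ-≤ 0ℚ (*-monoˡ-≤-nonNeg 1ℚ (φ≤ψ 1))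
step-mono (suc zero) φ≤ψ =
  +-mono-≤ (*-monoˡ-≤-nonNeg ½ (φ≤ψ 0)) (+-monoˡ-≤ 0ℚ (*-monoˡ-≤-nonNeg ½ (φ≤ψ 2)))
step-mono (suc (suc s)) φ≤ψ =
  +-mono-≤ (*-monoˡ-≤-nonNeg (+ 3 / 4) (φ≤ψ (suc s)))
           (+-monoˡ-≤ 0ℚ (*-monoˡ-≤-nonNeg (+ 1 / 4) (φ≤ψ (suc (suc (suc s))))))

-- Only positive states are considered: step 0 is empty, but the walk never reaches 0.
1-excessive≤probEvent : ∀ P (g : ℕ → ℕ → ℕ → ℚ) →
  (∀ s c → 1ℚ - g 0 (suc s) c ≤ probEvent 0 (suc s) c P) →
  (∀ r s c → expect (step (suc s)) (λ s′ → g r s′ (c ℕ.+ isOne s′)) ≤ g (suc r) (suc s) c) →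
  ∀ r s c → 1ℚ - g r (suc s) c ≤ probEvent r (suc s) c P
1-excessive≤probEvent P g terminal drift zero s c = terminal s c
1-excessive≤probEvent P g terminal drift (suc r) s c = begin
  1ℚ - g (suc r) (suc s) c          ≤⟨ +-monoʳ-≤ 1ℚ (neg-antimono-≤ (drift r s c)) ⟩
  1ℚ - expect X G                   ≡⟨ cong (_- expect X G) (step-total s) ⟨
  expect X (λ _ → 1ℚ) - expect X G  ≡⟨ expect-distrib-minus X (λ _ → 1ℚ) G ⟨
  expect X (λ s′ → 1ℚ - G s′)
    ≤⟨ step-mono s (λ s′ → 1-excessive≤probEvent P g terminal drift r s′ _) ⟩
  expect X (λ s′ → probEvent r s′ (c ℕ.+ isOne s′) P)
    ≡⟨ probEvent-suc r (suc s) c P ⟨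
  probEvent (suc r) (suc s) c P     ∎
  where
  X : List (ℚ × ℕ)
  X = step (suc s)
  G : ℕ → ℚ
  G s′ = g r s′ (c ℕ.+ isOne s′)

*-nonNeg : ∀ {x y} → 0ℚ ≤ x → 0ℚ ≤ y → 0ℚ ≤ x * y
*-nonNeg {x} {y} 0≤x 0≤y = nonNegative⁻¹ (x * y)
  {{nonNeg*nonNeg⇒nonNeg x {{nonNegative 0≤x}} y {{nonNegative 0≤y}}}}

^-nonNeg : ∀ x n → 0ℚ ≤ x → 0ℚ ≤ x ^ n
^-nonNeg x zero 0≤x = ≤ᵇ⇒≤ _
^-nonNeg x (suc n) 0≤x = *-nonNeg 0≤x (^-nonNeg x n 0≤x)

1≤* : ∀ {x y} → 1ℚ ≤ x → 1ℚ ≤ y → 1ℚ ≤ x * y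
1≤* {x} {y} 1≤x 1≤y = begin
  1ℚ      ≤⟨ 1≤y ⟩
  y       ≡⟨ *-identityˡ y ⟨
  1ℚ * y  ≤⟨ *-monoʳ-≤-nonNeg y {{nonNegative (≤-trans (≤ᵇ⇒≤ _) 1≤y)}} 1≤x ⟩
  x * y   ∎

1≤^ : ∀ x n → 1ℚ ≤ x → 1ℚ ≤ x ^ n
1≤^ x zero 1≤x = ≤-refl
1≤^ x (suc n) 1≤x = 1≤* 1≤x (1≤^ x n 1≤x)

1^n≡1 : ∀ n → 1ℚ ^ n ≡ 1ℚ
1^n≡1 zero = refl
1^n≡1 (suc n) = trans (*-identityˡ (1ℚ ^ n)) (1^n≡1 n)

ρ β γ : ℚ
ρ = + 9 / 10
β = + 11 / 10
γ = (+ 10 / 11) ^ 19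

γ*β^19≡1 : γ * β ^ 19 ≡ 1ℚ
γ*β^19≡1 = refl

lyapunov : ℕ → ℚ
lyapunov (suc (suc k)) = (+ 3 / 2) ^ k
lyapunov _ = + 3 / 2   -- state 1, and the unreachable state 0

1≤lyapunov : ∀ s → 1ℚ ≤ lyapunov s
1≤lyapunov (suc (suc k)) = 1≤^ (+ 3 / 2) k (≤ᵇ⇒≤ _)
1≤lyapunov zero = ≤ᵇ⇒≤ _
1≤lyapunov (suc zero) = ≤ᵇ⇒≤ _

lyapunov-drift : ∀ s →
  expect (step (suc s)) (λ s′ → lyapunov s′ * γ ^ isOne s′) ≤ ρ * lyapunov (suc s)
lyapunov-drift zero = ≤ᵇ⇒≤ _
lyapunov-drift (suc zero) = ≤ᵇ⇒≤ _
lyapunov-drift (suc (suc k)) = begin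
  + 3 / 4 * (a * 1ℚ) + (+ 1 / 4 * (h * (h * a) * 1ℚ) + 0ℚ)
    ≡⟨ solve 2 (λ h a → con (+ 3 / 4) :* (a :* con 1ℚ)
                          :+ (con (+ 1 / 4) :* (h :* (h :* a) :* con 1ℚ) :+ con 0ℚ)
                        := (con (+ 3 / 4) :+ con (+ 1 / 4) :* (h :* h)) :* a) refl h a ⟩
  (+ 3 / 4 + + 1 / 4 * (h * h)) * a
    ≤⟨ *-monoʳ-≤-nonNeg a {{nonNegative (^-nonNeg h k (≤ᵇ⇒≤ _))}} drift-coefficient ⟩
  ρ * h * a    ≡⟨ *-assoc ρ h a ⟩
  ρ * (h * a)  ∎
  where
  h a : ℚ
  h = + 3 / 2
  a = h ^ k
  drift-coefficient : + 3 / 4 + + 1 / 4 * (h * h) ≤ ρ * h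
  drift-coefficient = ≤ᵇ⇒≤ _

discount : (T₀ r c : ℕ) → ℚ
discount T₀ r c = ρ ^ r * (γ ^ c * β ^ T₀)

-- Bounds the probability that, from state s with c visits to 1 counted, fewer than T₀/19
-- visits have been counted after r more steps.
failureBound : (T₀ r s c : ℕ) → ℚ
failureBound T₀ r s c = lyapunov s * discount T₀ r c

discount-nonNeg : ∀ T₀ r c → 0ℚ ≤ discount T₀ r c
discount-nonNeg T₀ r c =
  *-nonNeg (^-nonNeg ρ r (≤ᵇ⇒≤ _)) (*-nonNeg (^-nonNeg γ c (≤ᵇ⇒≤ _)) (^-nonNeg β T₀ (≤ᵇ⇒≤ _)))

failureBound-nonNeg : ∀ T₀ r s c → 0ℚ ≤ failureBound T₀ r s c
failureBound-nonNeg T₀ r s c =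
  *-nonNeg (≤-trans (≤ᵇ⇒≤ _) (1≤lyapunov s)) (discount-nonNeg T₀ r c)

1≤discount : ∀ {T₀} c → 19 ℕ.* c ≤ℕ T₀ → 1ℚ ≤ discount T₀ 0 c
1≤discount {T₀} c 19c≤T₀ = begin
  1ℚ                                ≤⟨ 1≤^ β d (≤ᵇ⇒≤ _) ⟩
  β ^ d                             ≡⟨ *-identityˡ (β ^ d) ⟨
  1ℚ * β ^ d                        ≡⟨ cong (_* β ^ d) γ^c*β^19c≡1 ⟨
  γ ^ c * β ^ (19 ℕ.* c) * β ^ d    ≡⟨ *-assoc (γ ^ c) (β ^ (19 ℕ.* c)) (β ^ d) ⟩
  γ ^ c * (β ^ (19 ℕ.* c) * β ^ d)  ≡⟨ cong (γ ^ c *_) (^-homo-* β (19 ℕ.* c) d) ⟨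
  γ ^ c * β ^ (19 ℕ.* c ℕ.+ d)      ≡⟨ cong (λ n → γ ^ c * β ^ n) (ℕ.m+[n∸m]≡n 19c≤T₀) ⟩
  γ ^ c * β ^ T₀                    ≡⟨ *-identityˡ (γ ^ c * β ^ T₀) ⟨
  discount T₀ 0 c                   ∎
  where
  d : ℕ
  d = T₀ ℕ.∸ 19 ℕ.* c
  γ^c*β^19c≡1 : γ ^ c * β ^ (19 ℕ.* c) ≡ 1ℚ
  γ^c*β^19c≡1 = begin-equality
    γ ^ c * β ^ (19 ℕ.* c)  ≡⟨ cong (γ ^ c *_) (^-assocʳ β 19 c) ⟨
    γ ^ c * (β ^ 19) ^ c    ≡⟨ ^-distrib-* γ (β ^ 19) c ⟨
    (γ * β ^ 19) ^ c        ≡⟨ cong (_^ c) γ*β^19≡1 ⟩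
    1ℚ ^ c                  ≡⟨ 1^n≡1 c ⟩
    1ℚ                      ∎

1-p≤1 : ∀ {p} → 0ℚ ≤ p → 1ℚ - p ≤ 1ℚ
1-p≤1 0≤p = +-monoʳ-≤ 1ℚ (neg-antimono-≤ 0≤p)

1-p≤0 : ∀ {p} → 1ℚ ≤ p → 1ℚ - p ≤ 0ℚ
1-p≤0 {p} 1≤p = begin
  1ℚ - p  ≤⟨ +-monoˡ-≤ (- p) 1≤p ⟩
  p - p   ≡⟨ +-inverseʳ p ⟩
  0ℚ      ∎

1-p≤if : ∀ {A : Set} {b p} → Reflects A b → 0ℚ ≤ p → (¬ A → 1ℚ ≤ p) →
  1ℚ - p ≤ (if b then 1ℚ else 0ℚ)
1-p≤if (ofʸ _) 0≤p _ = 1-p≤1 0≤p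
1-p≤if (ofⁿ ¬a) _ 1≤p = 1-p≤0 (1≤p ¬a)

failureBound-terminal : ∀ T₀ s c →
  1ℚ - failureBound T₀ 0 s c ≤ probEvent 0 s c (λ n → T₀ ≤ᵇ 19 ℕ.* n)
failureBound-terminal T₀ s c =
  1-p≤if (ℕ.≤ᵇ-reflects-≤ T₀ (19 ℕ.* c)) (failureBound-nonNeg T₀ 0 s c)
    (λ T₀≰19c → 1≤* (1≤lyapunov s) (1≤discount c (ℕ.<⇒≤ (ℕ.≰⇒> T₀≰19c))))

failureBound-drift : ∀ T₀ r s c →
  expect (step (suc s)) (λ s′ → failureBound T₀ r s′ (c ℕ.+ isOne s′))
    ≤ failureBound T₀ (suc r) (suc s) c
failureBound-drift T₀ r s c = begin
  expect X (λ s′ → failureBound T₀ r s′ (c ℕ.+ isOne s′))  ≡⟨ expect-cong X split ⟩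
  expect X (λ s′ → V s′ * w)                               ≡⟨ expect-*ʳ X V w ⟩
  expect X V * w
    ≤⟨ *-monoʳ-≤-nonNeg w {{nonNegative (discount-nonNeg T₀ r c)}} (lyapunov-drift s) ⟩
  ρ * lyapunov (suc s) * w
    ≡⟨ solve 5 (λ ρ f a b e → ρ :* f :* (a :* (b :* e)) := f :* (ρ :* a :* (b :* e)))
         refl ρ (lyapunov (suc s)) (ρ ^ r) (γ ^ c) (β ^ T₀) ⟩
  failureBound T₀ (suc r) (suc s) c
    ∎
  where
  X : List (ℚ × ℕ)
  X = step (suc s)
  V : ℕ → ℚ
  V s′ = lyapunov s′ * γ ^ isOne s′
  w : ℚ
  w = discount T₀ r c
  split : ∀ s′ → failureBound T₀ r s′ (c ℕ.+ isOne s′) ≡ V s′ * w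
  split s′ = begin-equality
    lyapunov s′ * (ρ ^ r * (γ ^ (c ℕ.+ isOne s′) * β ^ T₀))
      ≡⟨ cong (λ z → lyapunov s′ * (ρ ^ r * (z * β ^ T₀))) (^-homo-* γ c (isOne s′)) ⟩
    lyapunov s′ * (ρ ^ r * (γ ^ c * γ ^ isOne s′ * β ^ T₀))
      ≡⟨ solve 5 (λ f a b g e → f :* (a :* (b :* g :* e)) := f :* g :* (a :* (b :* e)))
           refl (lyapunov s′) (ρ ^ r) (γ ^ c) (γ ^ isOne s′) (β ^ T₀) ⟩
    V s′ * w
      ∎

fromℕ : ℕ → ℚ
fromℕ n = ℚ-Mult._×_ n 1ℚ

fromℕ-nonNeg : ∀ n → 0ℚ ≤ fromℕ n
fromℕ-nonNeg zero = ≤-refl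
fromℕ-nonNeg (suc n) = nonNegative⁻¹ (1ℚ + fromℕ n)
  {{nonNeg+nonNeg⇒nonNeg 1ℚ (fromℕ n) {{nonNegative (fromℕ-nonNeg n)}}}}

fromℕ-mono : ∀ {m n} → m ≤ℕ n → fromℕ m ≤ fromℕ n
fromℕ-mono {m} {n} m≤n = begin
  fromℕ m                    ≡⟨ +-identityʳ (fromℕ m) ⟨
  fromℕ m + 0ℚ               ≤⟨ +-monoʳ-≤ (fromℕ m) (fromℕ-nonNeg (n ℕ.∸ m)) ⟩
  fromℕ m + fromℕ (n ℕ.∸ m)  ≡⟨ ℚ-Mult.×-homo-+ 1ℚ m (n ℕ.∸ m) ⟨
  fromℕ (m ℕ.+ (n ℕ.∸ m))    ≡⟨ cong fromℕ (ℕ.m+[n∸m]≡n m≤n) ⟩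
  fromℕ n                    ∎

toℚᵘ-fromℕ : ∀ n → toℚᵘ (fromℕ n) ≃ᵘ mkℚᵘ (+ n) 0
toℚᵘ-fromℕ zero = ℚᵘ.≃-refl
toℚᵘ-fromℕ (suc n) = ℚᵘ.≃-trans (toℚᵘ-homo-+ 1ℚ (fromℕ n))
  (ℚᵘ.≃-trans (ℚᵘ.+-congʳ (toℚᵘ 1ℚ) (toℚᵘ-fromℕ n))
    (*≡* (cong (λ i → (+ 1 ℤ.+ i) ℤ.* + 1) (ℤ.*-identityʳ (+ n)))))

-- ε · ↧ε = ↥ε ≥ 1, compared in ℚᵘ where the product is not normalised.
1≤ε*fromℕ↧ε : ∀ ε → 0ℚ < ε → 1ℚ ≤ ε * fromℕ (↧ₙ ε)
1≤ε*fromℕ↧ε ε@(mkℚ +[1+ n ] d-1 _) _ =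
  toℚᵘ-cancel-≤ (ℚᵘ.≤-respʳ-≃ (ℚᵘ.≃-sym toℚᵘ[ε*d]) (*≤* d≤[1+n]*d))
  where
  d : ℕ
  d = suc d-1
  toℚᵘ[ε*d] : toℚᵘ (ε * fromℕ d) ≃ᵘ mkℚᵘ +[1+ n ] d-1 ℚᵘ.* mkℚᵘ (+ d) 0
  toℚᵘ[ε*d] = ℚᵘ.≃-trans (toℚᵘ-homo-* ε (fromℕ d)) (ℚᵘ.*-congˡ {toℚᵘ ε} (toℚᵘ-fromℕ d))
  d≤[1+n]*d : + 1 ℤ.* + (d ℕ.* 1) ℤ.≤ (+[1+ n ] ℤ.* + d) ℤ.* + 1
  d≤[1+n]*d = subst₂ ℤ._≤_ (sym (ℤ.*-identityˡ (+ (d ℕ.* 1)))) (sym (ℤ.*-identityʳ (+[1+ n ] ℤ.* + d)))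
    (ℤ.+≤+ (ℕ.≤-trans (ℕ.≤-reflexive (ℕ.*-identityʳ d)) (ℕ.m≤n*m d (suc n))))
1≤ε*fromℕ↧ε (mkℚ (+ 0) _ _) (*<* (+<+ ()))
1≤ε*fromℕ↧ε (mkℚ -[1+ _ ] _ _) (*<* ())

fromℕ≤ε*fromℕ : ∀ {ε} → 0ℚ < ε → ∀ {k t} → ↧ₙ ε ℕ.* k ≤ℕ t → fromℕ k ≤ ε * fromℕ t
fromℕ≤ε*fromℕ {ε} 0<ε {k} {t} Dk≤t = begin
  fromℕ k                  ≡⟨ *-identityˡ (fromℕ k) ⟨
  1ℚ * fromℕ k
    ≤⟨ *-monoʳ-≤-nonNeg (fromℕ k) {{nonNegative (fromℕ-nonNeg k)}} (1≤ε*fromℕ↧ε ε 0<ε) ⟩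
  ε * fromℕ D * fromℕ k    ≡⟨ *-assoc ε (fromℕ D) (fromℕ k) ⟩
  ε * (fromℕ D * fromℕ k)  ≡⟨ cong (ε *_) (ℚ-Mult.×1-homo-* D k) ⟨
  ε * fromℕ (D ℕ.* k)      ≤⟨ *-monoˡ-≤-nonNeg ε {{nonNegative (<⇒≤ 0<ε)}} (fromℕ-mono Dk≤t) ⟩
  ε * fromℕ t              ∎
  where
  D : ℕ
  D = ↧ₙ ε

bernoulli : ∀ {x δ} → 0ℚ ≤ x → 0ℚ ≤ δ → x * (1ℚ + δ) ≤ 1ℚ →
  ∀ t → x ^ t * (1ℚ + fromℕ t * δ) ≤ 1ℚ
bernoulli {x} {δ} 0≤x 0≤δ x[1+δ]≤1 zero =
  ≤-reflexive (solve 1 (λ δ → con 1ℚ :* (con 1ℚ :+ con 0ℚ :* δ) := con 1ℚ) refl δ)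
bernoulli {x} {δ} 0≤x 0≤δ x[1+δ]≤1 (suc t) = begin
  x * x ^ t * (1ℚ + (1ℚ + fromℕ t) * δ)
    ≡⟨ solve 4 (λ x p n δ → x :* p :* (con 1ℚ :+ (con 1ℚ :+ n) :* δ)
                          := p :* (x :* (con 1ℚ :+ δ) :+ x :* (n :* δ)))
         refl x (x ^ t) (fromℕ t) δ ⟩
  x ^ t * (x * (1ℚ + δ) + x * (fromℕ t * δ))
    ≤⟨ *-monoˡ-≤-nonNeg (x ^ t) {{nonNegative (^-nonNeg x t 0≤x)}} (+-mono-≤ x[1+δ]≤1 x*tδ≤tδ) ⟩
  x ^ t * (1ℚ + fromℕ t * δ)
    ≤⟨ bernoulli 0≤x 0≤δ x[1+δ]≤1 t ⟩
  1ℚ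
    ∎
  where
  x≤1 : x ≤ 1ℚ
  x≤1 = ≤-trans (≤-trans (≤-reflexive (sym (*-identityʳ x)))
    (*-monoˡ-≤-nonNeg x {{nonNegative 0≤x}} (+-monoʳ-≤ 1ℚ 0≤δ))) x[1+δ]≤1
  x*tδ≤tδ : x * (fromℕ t * δ) ≤ fromℕ t * δ
  x*tδ≤tδ = ≤-trans
    (*-monoʳ-≤-nonNeg (fromℕ t * δ) {{nonNegative (*-nonNeg (fromℕ-nonNeg t) 0≤δ)}} x≤1)
    (≤-reflexive (*-identityˡ (fromℕ t * δ)))

failureBound-decay : ∀ {ε} → 0ℚ < ε → ∀ t → ↧ₙ ε ℕ.* 200 ≤ℕ t → failureBound t t 1 0 ≤ ε
failureBound-decay {ε} 0<ε t T≤t = begin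
  failureBound t t 1 0                    ≡⟨⟩
  + 3 / 2 * (ρ ^ t * (1ℚ * β ^ t))        ≡⟨ cong (λ z → + 3 / 2 * (ρ ^ t * z)) (*-identityˡ (β ^ t)) ⟩
  + 3 / 2 * (ρ ^ t * β ^ t)               ≡⟨ cong (+ 3 / 2 *_) (^-distrib-* ρ β t) ⟨
  + 3 / 2 * (ρ * β) ^ t
    ≤⟨ *-monoʳ-≤-nonNeg ((ρ * β) ^ t) {{nonNegative (^-nonNeg (ρ * β) t (≤ᵇ⇒≤ _))}} 3/2≤ε[1+tδ] ⟩
  ε * (1ℚ + fromℕ t * δ) * (ρ * β) ^ t
    ≡⟨ solve 3 (λ e a p → e :* a :* p := e :* (p :* a)) refl ε (1ℚ + fromℕ t * δ) ((ρ * β) ^ t) ⟩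
  ε * ((ρ * β) ^ t * (1ℚ + fromℕ t * δ))
    ≤⟨ *-monoˡ-≤-nonNeg ε {{nonNegative (<⇒≤ 0<ε)}} (bernoulli (≤ᵇ⇒≤ _) (≤ᵇ⇒≤ _) (≤ᵇ⇒≤ _) t) ⟩
  ε * 1ℚ                                  ≡⟨ *-identityʳ ε ⟩
  ε                                       ∎
  where
  δ : ℚ
  δ = + 1 / 100
  3/2≤ε[1+tδ] : + 3 / 2 ≤ ε * (1ℚ + fromℕ t * δ)
  3/2≤ε[1+tδ] = begin
    + 3 / 2                 ≤⟨ ≤ᵇ⇒≤ _ ⟩
    fromℕ 200 * δ           ≤⟨ *-monoʳ-≤-nonNeg δ (fromℕ≤ε*fromℕ 0<ε {200} T≤t) ⟩
    ε * fromℕ t * δ         ≡⟨ *-assoc ε (fromℕ t) δ ⟩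
    ε * (fromℕ t * δ)       ≤⟨ *-monoˡ-≤-nonNeg ε {{nonNegative (<⇒≤ 0<ε)}} (p≤1+p (fromℕ t * δ)) ⟩
    ε * (1ℚ + fromℕ t * δ)  ∎
    where
    p≤1+p : ∀ p → p ≤ 1ℚ + p
    p≤1+p p = ≤-trans (≤-reflexive (sym (+-identityˡ p))) (+-monoˡ-≤ p {0ℚ} {1ℚ} (≤ᵇ⇒≤ _))

theorem2 : (ε : ℚ) → 0ℚ < ε →
    Σ ℕ (λ T → (t : ℕ) → T ≤ℕ t → 1ℚ - ε ≤ probManyReturns t)
theorem2 ε 0<ε = ↧ₙ ε ℕ.* 200 , λ t T≤t → begin
  1ℚ - ε                     ≤⟨ +-monoʳ-≤ 1ℚ (neg-antimono-≤ (failureBound-decay 0<ε t T≤t)) ⟩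
  1ℚ - failureBound t t 1 0  ≤⟨ 1-excessive≤probEvent _ (failureBound t)
                                  (λ s → failureBound-terminal t (suc s)) (failureBound-drift t) t 0 0 ⟩
  probManyReturns t          ∎
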